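{- Let $m,n$ be integers with $0<m<n$, and let $\tfrac hk\in\mathcal F(\mathbb B(n),m;\rho)$ with $\tfrac01<\tfrac hk<\tfrac11$. (i) Let $x_0$ be the integer with $kx_0\equiv-1\pmod h$ and $m-h+1\le x_0\le m$; set $y_0:=\tfrac{kx_0+1}{h}$ and $t^\ast:=\bigl\lfloor\min\{\tfrac{m-x_0}{h},\tfrac{n-y_0}{k},\tfrac{n-m+x_0-y_0}{k-h}\}\bigr\rfloor$. Then the fraction $\tfrac{x_0+t^\ast h}{y_0+t^\ast k}$ immediately precedes $\tfrac hk$ in $\mathcal F(\mathbb B(n),m;\rho)$. (ii) Let $x_0$ be the integer with $kx_0\equiv1\pmod h$ and $m-h+1\le x_0\le m$; set $y_0:=\tfrac{kx_0-1}{h}$ and $t^\ast:=\bigl\lfloor\min\{\tfrac{m-x_0}{h},\tfrac{n-y_0}{k},\tfrac{n-m+x_0-y_0}{k-h}\}\bigr\rfloor$. Then the fraction $\tfrac{x_0+t^\ast h}{y_0+t^\ast k}$ immediately succeeds $\tfrac hk$ in $\mathcal F(\mathbb B(n),m;\rho)$.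
   Context: $\mathcal F_n$ is the Farey sequence of order $n$: the ascending sequence of all irreducible fractions in $[0,1]$ with denominator at most $n$. For $0\le m\le n$, $\mathcal F(\mathbb B(n),m;\rho)$ is the ascending sequence of irreducible fractions $\{\tfrac01,\tfrac11\}\cup\{\tfrac hk\in\mathcal F_n:\ h\le m,\ k-h\le n-m\}$ (equivalently, $\tfrac01,\tfrac11$ together with the reduced forms of $\rho(a\wedge b)/\rho(b)$ for $b\neq\hat0$ in the Boolean lattice $\mathbb B(n)$ of rank $n$, where $a$ is a fixed element of rank $m$ and $\rho$ is rank). -}

module Defs where

open import Data.Nat using (ℕ; zero; suc; _*_; _∸_; _≤_; _<_)
open import Data.Nat.Coprimality using (Coprime)
open import Data.Integer using (ℤ; +_)
import Data.Integer as ℤ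
open import Data.Rational using (ℚ; _/_; _⊓_; floor)
import Data.Rational as ℚ
open import Data.Product using (_×_)
open import Data.Sum using (_⊎_)
open import Relation.Binary.PropositionalEquality using (_≡_)
open import Relation.Nullary using (¬_)

InFarey : ℕ → ℕ → ℕ → Set
InFarey n h k = Coprime h k × 1 ≤ k × k ≤ n × h ≤ k

-- h/k ∈ F(B(n), m; ρ) = {0/1, 1/1} ∪ {h/k ∈ F_n : h ≤ m, k - h ≤ n - m}
InFB : ℕ → ℕ → ℕ → ℕ → Set
InFB n m h k =
  ((h ≡ 0 × k ≡ 1) ⊎ (h ≡ 1 × k ≡ 1))
  ⊎ (InFarey n h k × h ≤ m × k ∸ h ≤ n ∸ m)

-- strict order of fractions with positive denominators: a/b < c/d
_/_<ᶠ_/_ : ℕ → ℕ → ℕ → ℕ → Set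
a / b <ᶠ c / d = a * d < c * b

ImmPrecedes : ℕ → ℕ → ℕ → ℕ → ℕ → ℕ → Set
ImmPrecedes n m p q h k =
  InFB n m p q × (p / q <ᶠ h / k)
  × (∀ a b → InFB n m a b → ¬ ((p / q <ᶠ a / b) × (a / b <ᶠ h / k)))

ImmSucceeds : ℕ → ℕ → ℕ → ℕ → ℕ → ℕ → Set
ImmSucceeds n m p q h k =
  InFB n m p q × (h / k <ᶠ p / q)
  × (∀ a b → InFB n m a b → ¬ ((h / k <ᶠ a / b) × (a / b <ᶠ p / q)))

-- the rational a/d for an integer a and natural d > 0
-- (junk value 0 for d = 0; never used with d = 0 in the statement)
frac : ℤ → ℕ → ℚ
frac a zero = ℚ.0ℚ
frac a (suc d) = a / suc d

tStar : ℕ → ℕ → ℕ → ℕ → ℤ → ℤ → ℤ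
tStar n m h k x0 y0 =
  floor ((frac (+ m ℤ.- x0) h ⊓ frac (+ n ℤ.- y0) k)
         ⊓ frac (+ n ℤ.- + m ℤ.+ x0 ℤ.- y0) (k ∸ h))

{-# OPTIONS --safe #-}
-- Write the fraction a/b as the lattice point (b − a, a). Then F(B(n),m;ρ) consists of the
-- primitive points of the box [0, n − m] × [0, m], and a/b < c/d iff det((b − a, a), (d − c, c))
-- = bc − ad is positive. With u = (k − h, h), the solutions of h y − k x = ±1 are the points v
-- with det(v, u) = ±1; they lie on a line in direction u, and t* selects the last point v on it
-- below the corner (n − m, m), so that v + u is not below it. Since |det(v, u)| ≤ 1, the
-- coordinates of v cannot have strictly opposite signs; if one were negative, v + u ≤ u would
-- stay below the corner, hence v ≥ 0 and v is a fraction of F(B(n),m;ρ). A point w strictly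
-- between v and u is w = det(w, u) v + det(v, w) u with both coefficients ≥ 1 (Cramer's rule),
-- so w ≥ v + u is not below the corner.

module Submission where

open import Defs
open import Data.Nat using (ℕ; _<_)
open import Data.Integer using (ℤ; +_; _+_; _-_; _*_; _≤_; 1ℤ)
open import Data.Product using (_×_; ∃₂)
open import Relation.Binary.PropositionalEquality using (_≡_)

open import Data.Nat using (suc; _∸_; z≤n; s≤s)
import Data.Nat as ℕ
import Data.Nat.Properties as ℕ
open import Data.Nat.Coprimality using (Coprime; 0-coprimeTo-m⇒m≡1)
open import Data.Nat.Divisibility using (_∣_; ∣-trans; ∣1⇒≡1; ∣m+n∣m⇒∣n; m∣m*n; n∣m*n)
open import Data.Integer using (-_; 0ℤ; -1ℤ; +<+; -<-; -<+; -≤+; +≤+; ∣_∣)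
import Data.Integer as ℤ
open import Data.Integer.Properties
  using (≤-trans; ≤-reflexive; <⇒≤; <⇒≱; ≮⇒≥; +-mono-≤; *-monoʳ-≤-nonNeg; *-identityˡ;
         *-identityʳ; +-identityˡ; +-comm; i≤j⇒0≤j-i; 0≤i-j⇒j≤i; drop‿+≤+; +-injective;
         pos-*; m-n≡m⊖n; ≤-⊖; 0≤i⇒+∣i∣≡i; module ≤-Reasoning)
open import Data.Integer.DivMod using ([n/d]*d≤n; n<s[n/ℕd]*d; div-pos-is-/ℕ)
open import Data.Integer.Tactic.RingSolver using (solve-∀; solve)
open import Data.Rational using (ℚ; floor; ↥_; ↧_; _⊓_)
import Data.Rational as ℚ
import Data.Rational.Properties as ℚ
open import Data.Rational.Literals using (fromℤ)
import Data.Rational.Unnormalised as ℚᵘ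
import Data.Rational.Unnormalised.Properties as ℚᵘ
open import Data.Product using (_,_; proj₁; proj₂)
open import Data.Sum using (inj₁; inj₂)
open import Data.List using (_∷_; [])
open import Function.Base using (_∘_)
open import Function.Bundles using (_⇔_; mk⇔; module Equivalence)
open import Relation.Nullary using (¬_; contradiction)
open import Relation.Binary.PropositionalEquality
  using (refl; sym; trans; cong; cong₂; subst; subst₂; module ≡-Reasoning)

pos-∸ : ∀ {a b} → a ℕ.≤ b → + (b ∸ a) ≡ + b - + a
pos-∸ {a} {b} a≤b = sym (trans (m-n≡m⊖n b a) (≤-⊖ a≤b))

≤-by-difference : ∀ {i j k l} → i ≤ j → j - i ≡ l - k → k ≤ l
≤-by-difference i≤j eq = 0≤i-j⇒j≤i (subst (0ℤ ≤_) eq (i≤j⇒0≤j-i i≤j))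

i≤j*i : ∀ {i j} → 0ℤ ≤ i → 1ℤ ≤ j → i ≤ j * i
i≤j*i {i} {j} 0≤i 1≤j = subst (_≤ j * i) (*-identityˡ i) (*-monoʳ-≤-nonNeg i {{ℤ.nonNegative 0≤i}} 1≤j)

infixl 6 _+²_
infix 4 _≤²_ _<²_

ℤ² : Set
ℤ² = ℤ × ℤ

0² : ℤ²
0² = 0ℤ , 0ℤ

_+²_ : ℤ² → ℤ² → ℤ²
(a , b) +² (c , d) = a + c , b + d

_≤²_ : ℤ² → ℤ² → Set
(a , b) ≤² (c , d) = a ≤ c × b ≤ d

_<²_ : ℤ² → ℤ² → Set
(a , b) <² (c , d) = a ℤ.< c × b ℤ.< d

det : ℤ² → ℤ² → ℤ
det (a , b) (c , d) = a * d - b * c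

≤²-trans : ∀ {v w z} → v ≤² w → w ≤² z → v ≤² z
≤²-trans (a , b) (c , d) = ≤-trans a c , ≤-trans b d

+²-comm : ∀ v w → v +² w ≡ w +² v
+²-comm (a , b) (c , d) = cong₂ _,_ (+-comm a c) (+-comm b d)

det-antisym : ∀ v w → det v w ≡ - det w v
det-antisym (a , b) (c , d) = antisym a b c d
  where
  antisym : ∀ a b c d → a * d - b * c ≡ - (c * b - d * a)
  antisym = solve-∀

-- By Cramer's rule, w = det w u · v + det v w · u when det v u = 1.
mediant-≤-between : ∀ {v u w} → 0² ≤² v → 0² ≤² u → det v u ≡ 1ℤ
                  → 1ℤ ≤ det v w → 1ℤ ≤ det w u → v +² u ≤² w
mediant-≤-between {v₁ , v₂} {u₁ , u₂} {w₁ , w₂} (0≤v₁ , 0≤v₂) (0≤u₁ , 0≤u₂) unimodular 1≤β 1≤α =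
  component 0≤v₁ 0≤u₁ (cramer₁ v₁ v₂ u₁ u₂ w₁ w₂) , component 0≤v₂ 0≤u₂ (cramer₂ v₁ v₂ u₁ u₂ w₁ w₂)
  where
  α β : ℤ
  α = det (w₁ , w₂) (u₁ , u₂)
  β = det (v₁ , v₂) (w₁ , w₂)
  cramer₁ : ∀ a b c d e f → e * (a * d - b * c) ≡ (e * d - f * c) * a + (a * f - b * e) * c
  cramer₁ = solve-∀
  cramer₂ : ∀ a b c d e f → f * (a * d - b * c) ≡ (e * d - f * c) * b + (a * f - b * e) * d
  cramer₂ = solve-∀
  component : ∀ {x y z} → 0ℤ ≤ x → 0ℤ ≤ y → z * det (v₁ , v₂) (u₁ , u₂) ≡ α * x + β * y → x + y ≤ z
  component {x} {y} {z} 0≤x 0≤y cramer = begin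
    x + y                       ≤⟨ +-mono-≤ (i≤j*i 0≤x 1≤α) (i≤j*i 0≤y 1≤β) ⟩
    α * x + β * y               ≡⟨ cramer ⟨
    z * det (v₁ , v₂) (u₁ , u₂) ≡⟨ cong (z *_) unimodular ⟩
    z * 1ℤ                      ≡⟨ *-identityʳ z ⟩
    z                           ∎
    where open ≤-Reasoning

-- With the signs fixed by the patterns both products reduce, so det evaluates symbolically.
det-mixed-signs-< : ∀ {a b c d} → a ℤ.< 0ℤ → 0ℤ ℤ.< b → 0ℤ ℤ.< c → 0ℤ ℤ.< d
                  → det (a , b) (c , d) ℤ.< -1ℤ
det-mixed-signs-< -<+ (+<+ (s≤s _)) (+<+ (s≤s _)) (+<+ (s≤s _)) = -<- (s≤s z≤n)
det-mixed-signs-< (+<+ ()) _ _ _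

det-mixed-signs-> : ∀ {a b c d} → 0ℤ ℤ.< a → b ℤ.< 0ℤ → 0ℤ ℤ.< c → 0ℤ ℤ.< d
                  → 1ℤ ℤ.< det (a , b) (c , d)
det-mixed-signs-> (+<+ (s≤s {n = a} _)) -<+ (+<+ (s≤s _)) (+<+ (s≤s {n = d} _)) =
  +<+ (s≤s (ℕ.m≤n⇒m≤o+n (d ℕ.+ a ℕ.* suc d) (s≤s z≤n)))
det-mixed-signs-> _ (+<+ ()) _ _

nonPos-+²-≤² : ∀ {v u c} → v ≤² 0² → u ≤² c → v +² u ≤² c
nonPos-+²-≤² (v₁≤0 , v₂≤0) (u₁≤c₁ , u₂≤c₂) =
  ≤-trans (+-mono-≤ v₁≤0 u₁≤c₁) (≤-reflexive (+-identityˡ _)) ,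
  ≤-trans (+-mono-≤ v₂≤0 u₂≤c₂) (≤-reflexive (+-identityˡ _))

+²-≰⇒0≤² : ∀ {v u c} → 0² <² u → u ≤² c → -1ℤ ≤ det v u → det v u ≤ 1ℤ
         → ¬ (v +² u ≤² c) → 0² ≤² v
+²-≰⇒0≤² {v₁ , v₂} (0<u₁ , 0<u₂) u≤c -1≤det det≤1 v+u≰c = 0≤v₁ , 0≤v₂
  where
  ¬nonPos : ¬ (v₁ ≤ 0ℤ × v₂ ≤ 0ℤ)
  ¬nonPos v≤0 = v+u≰c (nonPos-+²-≤² v≤0 u≤c)
  0≤v₁ : 0ℤ ≤ v₁
  0≤v₁ = ≮⇒≥ λ v₁<0 → ¬nonPos (<⇒≤ v₁<0 , ≮⇒≥ λ 0<v₂ →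
           <⇒≱ (det-mixed-signs-< v₁<0 0<v₂ 0<u₁ 0<u₂) -1≤det)
  0≤v₂ : 0ℤ ≤ v₂
  0≤v₂ = ≮⇒≥ λ v₂<0 → ¬nonPos (≮⇒≥ (λ 0<v₁ →
           <⇒≱ (det-mixed-signs-> 0<v₁ v₂<0 0<u₁ 0<u₂) det≤1) , <⇒≤ v₂<0)

point : ℤ → ℤ → ℤ²
point a b = b - a , a

det-point : ∀ a b c d → det (point a b) (point c d) ≡ c * b - a * d
det-point = expand
  where
  expand : ∀ a b c d → (b - a) * c - a * (d - c) ≡ c * b - a * d
  expand = solve-∀

det-point-on-line : ∀ a b {x y e} t → a * y ≡ b * x + e
                  → det (point (x + t * a) (y + t * b)) (point a b) ≡ e
det-point-on-line a b {x} {y} {e} t eq = begin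
  det (point (x + t * a) (y + t * b)) (point a b) ≡⟨ det-point (x + t * a) (y + t * b) a b ⟩
  a * (y + t * b) - (x + t * a) * b               ≡⟨ solve (a ∷ b ∷ x ∷ y ∷ t ∷ []) ⟩
  a * y - x * b                                   ≡⟨ cong (_- x * b) eq ⟩
  b * x + e - x * b                               ≡⟨ solve (b ∷ x ∷ e ∷ []) ⟩
  e                                               ∎
  where open ≡-Reasoning

det-point-ℕ : ∀ a b c d → det (point (+ a) (+ b)) (point (+ c) (+ d)) ≡ + (c ℕ.* b) - + (a ℕ.* d)
det-point-ℕ a b c d = trans (det-point (+ a) (+ b) (+ c) (+ d)) (sym (cong₂ _-_ (pos-* c b) (pos-* a d)))

module _ (a b c d : ℕ) where

  private
    det-minus-1 : + (c ℕ.* b) - (1ℤ + + (a ℕ.* d)) ≡ det (point (+ a) (+ b)) (point (+ c) (+ d)) - 1ℤ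
    det-minus-1 = trans (shift (+ (c ℕ.* b)) (+ (a ℕ.* d))) (cong (_- 1ℤ) (sym (det-point-ℕ a b c d)))
      where
      shift : ∀ x y → x - (1ℤ + y) ≡ x - y - 1ℤ
      shift = solve-∀

  <ᶠ⇒1≤det : a / b <ᶠ c / d → 1ℤ ≤ det (point (+ a) (+ b)) (point (+ c) (+ d))
  <ᶠ⇒1≤det ad<cb = ≤-by-difference (+≤+ ad<cb) det-minus-1

  1≤det⇒<ᶠ : 1ℤ ≤ det (point (+ a) (+ b)) (point (+ c) (+ d)) → a / b <ᶠ c / d
  1≤det⇒<ᶠ 1≤det = drop‿+≤+ (≤-by-difference 1≤det (sym det-minus-1))

unimodular⇒coprime : ∀ a b c d → det (point (+ a) (+ b)) (point (+ c) (+ d)) ≡ 1ℤ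
                   → Coprime a b × Coprime c d
unimodular⇒coprime a b c d unimodular =
  (λ (i∣a , i∣b) → divides-1 (∣-trans i∣a (m∣m*n d)) (∣-trans i∣b (n∣m*n c))) ,
  (λ (i∣c , i∣d) → divides-1 (∣-trans i∣d (n∣m*n a)) (∣-trans i∣c (m∣m*n b)))
  where
  bézout : a ℕ.* d ℕ.+ 1 ≡ c ℕ.* b
  bézout = +-injective (begin
    + (a ℕ.* d) + 1ℤ                          ≡⟨ cong (_+_ (+ (a ℕ.* d))) unimodular ⟨
    + (a ℕ.* d) + det (point (+ a) (+ b)) (point (+ c) (+ d))
                                              ≡⟨ cong (_+_ (+ (a ℕ.* d))) (det-point-ℕ a b c d) ⟩
    + (a ℕ.* d) + (+ (c ℕ.* b) - + (a ℕ.* d)) ≡⟨ cancel (+ (a ℕ.* d)) (+ (c ℕ.* b)) ⟩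
    + (c ℕ.* b)                               ∎)
    where
    open ≡-Reasoning
    cancel : ∀ x y → x + (y - x) ≡ y
    cancel = solve-∀
  divides-1 : ∀ {i} → i ∣ a ℕ.* d → i ∣ c ℕ.* b → i ≡ 1
  divides-1 {i} i∣ad i∣cb = ∣1⇒≡1 (∣m+n∣m⇒∣n (subst (i ∣_) (sym bézout) i∣cb) i∣ad)

nonNeg-point⇒ℕ : ∀ {P Q} → 0² ≤² point P Q → ∃₂ λ p q → + p ≡ P × + q ≡ Q
nonNeg-point⇒ℕ {P} {Q} (0≤Q-P , 0≤P) =
  ∣ P ∣ , ∣ Q ∣ , 0≤i⇒+∣i∣≡i 0≤P , 0≤i⇒+∣i∣≡i (≤-trans 0≤P (0≤i-j⇒j≤i 0≤Q-P))

InFB⇒box : ∀ {n m a b} → 0 < m → m < n → InFB n m a b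
         → 0² ≤² point (+ a) (+ b) × point (+ a) (+ b) ≤² point (+ m) (+ n)
InFB⇒box 0<m m<n (inj₁ (inj₁ (refl , refl))) =
  (+≤+ z≤n , +≤+ z≤n) , (subst (1ℤ ≤_) (pos-∸ (ℕ.<⇒≤ m<n)) (+≤+ (ℕ.m<n⇒0<n∸m m<n)) , +≤+ z≤n)
InFB⇒box 0<m m<n (inj₁ (inj₂ (refl , refl))) =
  (+≤+ z≤n , +≤+ z≤n) , (subst (0ℤ ≤_) (pos-∸ (ℕ.<⇒≤ m<n)) (+≤+ z≤n) , +≤+ 0<m)
InFB⇒box 0<m m<n (inj₂ ((_ , _ , _ , a≤b) , a≤m , b∸a≤n∸m)) =
  (subst (0ℤ ≤_) (pos-∸ a≤b) (+≤+ z≤n) , +≤+ z≤n) ,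
  (subst₂ _≤_ (pos-∸ a≤b) (pos-∸ (ℕ.<⇒≤ m<n)) (+≤+ b∸a≤n∸m) , +≤+ a≤m)

coprime-≤⇒0< : ∀ {p q} → Coprime p q → p ℕ.≤ q → 0 < q
coprime-≤⇒0< {q = suc _} _ _ = s≤s z≤n
coprime-≤⇒0< {q = ℕ.zero} coprime z≤n = contradiction (0-coprimeTo-m⇒m≡1 coprime) λ ()

box⇒InFB : ∀ {n m p q} → m ℕ.≤ n → 0² ≤² point (+ p) (+ q) → point (+ p) (+ q) ≤² point (+ m) (+ n)
         → Coprime p q → InFB n m p q
box⇒InFB {n} {m} {p} {q} m≤n (0≤q-p , _) (q-p≤n-m , p≤m) coprime =
  inj₂ ((coprime , coprime-≤⇒0< coprime p≤q , q≤n , p≤q) , drop‿+≤+ p≤m , q∸p≤n∸m)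
  where
  p≤q : p ℕ.≤ q
  p≤q = drop‿+≤+ (0≤i-j⇒j≤i 0≤q-p)
  q∸p≤n∸m : q ∸ p ℕ.≤ n ∸ m
  q∸p≤n∸m = drop‿+≤+ (subst₂ _≤_ (sym (pos-∸ p≤q)) (sym (pos-∸ m≤n)) q-p≤n-m)
  q≤n : q ℕ.≤ n
  q≤n = subst₂ ℕ._≤_ (ℕ.m∸n+n≡m p≤q) (ℕ.m∸n+n≡m m≤n) (ℕ.+-mono-≤ q∸p≤n∸m (drop‿+≤+ p≤m))

floor-≤ : ∀ r → fromℤ (floor r) ℚ.≤ r
floor-≤ r@record{} = ℚ.*≤* (begin
  floor r * ↧ r ≤⟨ [n/d]*d≤n (↥ r) (↧ r) ⟩
  ↥ r           ≡⟨ *-identityʳ (↥ r) ⟨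
  ↥ r * 1ℤ      ∎)
  where open ≤-Reasoning

1+floor-≰ : ∀ r → ¬ (fromℤ (1ℤ + floor r) ℚ.≤ r)
1+floor-≰ r@(ℚ.mkℚ a d _) (ℚ.*≤* 1+floor≤r) = <⇒≱ (begin-strict
  a * 1ℤ                         ≡⟨ *-identityʳ a ⟩
  a                              <⟨ n<s[n/ℕd]*d a (suc d) ⟩
  ℤ.suc (a ℤ./ℕ suc d) * + suc d ≡⟨ cong (λ t → ℤ.suc t * + suc d) (div-pos-is-/ℕ a (suc d)) ⟨
  (1ℤ + floor r) * ↧ r           ∎) 1+floor≤r
  where open ≤-Reasoning

fromℤ≤frac⇔ : ∀ t a {d} → 0 < d → fromℤ t ℚ.≤ frac a d ⇔ t * + d ≤ a
fromℤ≤frac⇔ t a {suc d} _ = mk⇔ to from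
  where
  -- frac a (suc d) is definitionally fromℚᵘ (mkℚᵘ a d).
  a/d≃ : ℚ.toℚᵘ (frac a (suc d)) ℚᵘ.≃ ℚᵘ.mkℚᵘ a d
  a/d≃ = ℚ.toℚᵘ-fromℚᵘ (ℚᵘ.mkℚᵘ a d)
  to : fromℤ t ℚ.≤ frac a (suc d) → t * + suc d ≤ a
  to t≤a/d with ℚᵘ.≤-respʳ-≃ a/d≃ (ℚ.toℚᵘ-mono-≤ t≤a/d)
  ... | ℚᵘ.*≤* td≤a = subst (t * + suc d ≤_) (*-identityʳ a) td≤a
  from : t * + suc d ≤ a → fromℤ t ℚ.≤ frac a (suc d)
  from td≤a = ℚ.toℚᵘ-cancel-≤ (ℚᵘ.≤-respʳ-≃ (ℚᵘ.≃-sym a/d≃)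
                (ℚᵘ.*≤* (subst (t * + suc d ≤_) (sym (*-identityʳ a)) td≤a)))

bounds⇒line-≤² : ∀ M N H K x y t → t * H ≤ M - x → t * (K - H) ≤ N - M + x - y
               → point (x + t * H) (y + t * K) ≤² point M N
bounds⇒line-≤² M N H K x y t tH≤M-x t[K-H]≤N-M+x-y =
  ≤-by-difference {k = (y + t * K) - (x + t * H)} {l = N - M} t[K-H]≤N-M+x-y
    (solve (M ∷ N ∷ H ∷ K ∷ x ∷ y ∷ t ∷ [])) ,
  ≤-by-difference {k = x + t * H} {l = M} tH≤M-x (solve (M ∷ H ∷ x ∷ t ∷ []))

line-next-≤²⇒bounds : ∀ M N H K x y t
  → (y + t * K) - (x + t * H) + (K - H) ≤ N - M → x + t * H + H ≤ M
  → (1ℤ + t) * H ≤ M - x × (1ℤ + t) * K ≤ N - y × (1ℤ + t) * (K - H) ≤ N - M + x - y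
line-next-≤²⇒bounds M N H K x y t Q′-P′≤N-M P′≤M =
  ≤-by-difference {k = (1ℤ + t) * H} {l = M - x} P′≤M (solve (M ∷ H ∷ x ∷ t ∷ [])) ,
  ≤-by-difference {k = (1ℤ + t) * K} {l = N - y} (+-mono-≤ Q′-P′≤N-M P′≤M)
    (solve (M ∷ N ∷ H ∷ K ∷ x ∷ y ∷ t ∷ [])) ,
  ≤-by-difference {k = (1ℤ + t) * (K - H)} {l = N - M + x - y} Q′-P′≤N-M
    (solve (M ∷ N ∷ H ∷ K ∷ x ∷ y ∷ t ∷ []))

LastBelow : ℤ² → ℤ² → ℤ² → Set
LastBelow c u v = v ≤² c × ¬ (v +² u ≤² c)

tStar-lastBelow : ∀ {n m h k} → 0 < h → h < k → ∀ x0 y0 → let t = tStar n m h k x0 y0 in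
  LastBelow (point (+ m) (+ n)) (point (+ h) (+ k)) (point (x0 + t * + h) (y0 + t * + k))
tStar-lastBelow {n} {m} {h} {k} 0<h h<k x0 y0 = v≤c , v+u≰c
  where
  open Equivalence using (to; from)
  0<k-h : 0 < k ∸ h
  0<k-h = ℕ.m<n⇒0<n∸m h<k
  K-H : + (k ∸ h) ≡ + k - + h
  K-H = pos-∸ (ℕ.<⇒≤ h<k)
  a₃ : ℤ
  a₃ = + n - + m + x0 - y0
  f₁ f₂ f₃ r : ℚ
  f₁ = frac (+ m - x0) h
  f₂ = frac (+ n - y0) k
  f₃ = frac a₃ (k ∸ h)
  r = (f₁ ⊓ f₂) ⊓ f₃
  t : ℤ
  t = floor r
  v u c : ℤ²
  v = point (x0 + t * + h) (y0 + t * + k)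
  u = point (+ h) (+ k)
  c = point (+ m) (+ n)
  t≤f₁ : fromℤ t ℚ.≤ f₁
  t≤f₁ = ℚ.≤-trans (floor-≤ r) (ℚ.≤-trans (ℚ.p⊓q≤p (f₁ ⊓ f₂) f₃) (ℚ.p⊓q≤p f₁ f₂))
  t≤f₃ : fromℤ t ℚ.≤ f₃
  t≤f₃ = ℚ.≤-trans (floor-≤ r) (ℚ.p⊓q≤q (f₁ ⊓ f₂) f₃)
  v≤c : v ≤² c
  v≤c = bounds⇒line-≤² (+ m) (+ n) (+ h) (+ k) x0 y0 t
          (to (fromℤ≤frac⇔ t _ 0<h) t≤f₁)
          (subst (λ d → t * d ≤ a₃) K-H (to (fromℤ≤frac⇔ t _ 0<k-h) t≤f₃))
  v+u≰c : ¬ (v +² u ≤² c)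
  v+u≰c (Q′-P′≤N-M , P′≤M) =
    let (s≤a₁ , s≤a₂ , s≤a₃) = line-next-≤²⇒bounds (+ m) (+ n) (+ h) (+ k) x0 y0 t Q′-P′≤N-M P′≤M
    in 1+floor-≰ r (ℚ.⊓-glb (ℚ.⊓-glb (from (fromℤ≤frac⇔ (1ℤ + t) _ 0<h) s≤a₁)
                                     (from (fromℤ≤frac⇔ (1ℤ + t) _ (ℕ.<-trans 0<h h<k)) s≤a₂))
                            (from (fromℤ≤frac⇔ (1ℤ + t) _ 0<k-h)
                                  (subst (λ d → (1ℤ + t) * d ≤ a₃) (sym K-H) s≤a₃)))

module Neighbours {n m h k : ℕ} (0<m : 0 < m) (m<n : m < n) (hk∈FB : InFB n m h k)
                  (0<h : 0 < h) (h<k : h < k) where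

  u c : ℤ²
  u = point (+ h) (+ k)
  c = point (+ m) (+ n)

  0≤u : 0² ≤² u
  0≤u = proj₁ (InFB⇒box 0<m m<n hk∈FB)

  u≤c : u ≤² c
  u≤c = proj₂ (InFB⇒box 0<m m<n hk∈FB)

  0<u : 0² <² u
  0<u = subst (0ℤ ℤ.<_) (pos-∸ (ℕ.<⇒≤ h<k)) (+<+ (ℕ.m<n⇒0<n∸m h<k)) , +<+ 0<h

  no-FB-between : ∀ {v w} → 0² ≤² v → 0² ≤² w → det v w ≡ 1ℤ → ¬ (v +² w ≤² c)
                → ∀ a b → InFB n m a b
                → ¬ (1ℤ ≤ det v (point (+ a) (+ b)) × 1ℤ ≤ det (point (+ a) (+ b)) w)
  no-FB-between 0≤v 0≤w det≡1 v+w≰c a b ab∈FB (1≤det₁ , 1≤det₂) =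
    v+w≰c (≤²-trans (mediant-≤-between 0≤v 0≤w det≡1 1≤det₁ 1≤det₂) (proj₂ (InFB⇒box 0<m m<n ab∈FB)))

  predecessor : ∀ {P Q} → LastBelow c u (point P Q) → det (point P Q) u ≡ 1ℤ
              → ∃₂ λ p q → + p ≡ P × + q ≡ Q × ImmPrecedes n m p q h k
  predecessor {P} {Q} (v≤c , v+u≰c) det≡1
    with 0≤v ← +²-≰⇒0≤² 0<u u≤c (subst (-1ℤ ≤_) (sym det≡1) -≤+) (≤-reflexive det≡1) v+u≰c
    with p , q , refl , refl ← nonNeg-point⇒ℕ {P} {Q} 0≤v =
    p , q , refl , refl ,
    box⇒InFB (ℕ.<⇒≤ m<n) 0≤v v≤c (proj₁ (unimodular⇒coprime p q h k det≡1)) ,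
    1≤det⇒<ᶠ p q h k (≤-reflexive (sym det≡1)) ,
    λ a b ab∈FB (v<w , w<u) →
      no-FB-between 0≤v 0≤u det≡1 v+u≰c a b ab∈FB (<ᶠ⇒1≤det p q a b v<w , <ᶠ⇒1≤det a b h k w<u)

  successor : ∀ {P Q} → LastBelow c u (point P Q) → det (point P Q) u ≡ -1ℤ
            → ∃₂ λ p q → + p ≡ P × + q ≡ Q × ImmSucceeds n m p q h k
  successor {P} {Q} (v≤c , v+u≰c) det≡-1
    with 0≤v ← +²-≰⇒0≤² 0<u u≤c (≤-reflexive (sym det≡-1)) (subst (_≤ 1ℤ) (sym det≡-1) -≤+) v+u≰c
    with p , q , refl , refl ← nonNeg-point⇒ℕ {P} {Q} 0≤v =
    p , q , refl , refl ,
    box⇒InFB (ℕ.<⇒≤ m<n) 0≤v v≤c (proj₂ (unimodular⇒coprime h k p q det-u-v≡1)) ,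
    1≤det⇒<ᶠ h k p q (≤-reflexive (sym det-u-v≡1)) ,
    λ a b ab∈FB (u<w , w<v) →
      no-FB-between 0≤u 0≤v det-u-v≡1 u+v≰c a b ab∈FB (<ᶠ⇒1≤det h k a b u<w , <ᶠ⇒1≤det a b p q w<v)
    where
    det-u-v≡1 : det u (point P Q) ≡ 1ℤ
    det-u-v≡1 = trans (det-antisym u (point P Q)) (cong -_ det≡-1)
    u+v≰c : ¬ (u +² point P Q ≤² c)
    u+v≰c = v+u≰c ∘ subst (_≤² c) (+²-comm u (point P Q))

proposition7p5 : (m n : ℕ) → 0 < m → m < n → (h k : ℕ) → InFB n m h k
    → (0 / 1 <ᶠ h / k) → (h / k <ᶠ 1 / 1)
    → ((x0 y0 : ℤ) → + h * y0 ≡ + k * x0 + 1ℤ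
         → + m - + h + 1ℤ ≤ x0 → x0 ≤ + m
         → ∃₂ λ p q → + p ≡ x0 + tStar n m h k x0 y0 * + h
             × + q ≡ y0 + tStar n m h k x0 y0 * + k
             × ImmPrecedes n m p q h k)
    × ((x0 y0 : ℤ) → + h * y0 ≡ + k * x0 - 1ℤ
         → + m - + h + 1ℤ ≤ x0 → x0 ≤ + m
         → ∃₂ λ p q → + p ≡ x0 + tStar n m h k x0 y0 * + h
             × + q ≡ y0 + tStar n m h k x0 y0 * + k
             × ImmSucceeds n m p q h k)
proposition7p5 m n 0<m m<n h k hk∈FB 0/1<h/k h/k<1/1 =
  (λ x0 y0 hy0≡kx0+1 _ _ → predecessor (tStar-lastBelow 0<h h<k x0 y0)
                             (det-point-on-line (+ h) (+ k) (tStar n m h k x0 y0) hy0≡kx0+1)) ,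
  (λ x0 y0 hy0≡kx0-1 _ _ → successor (tStar-lastBelow 0<h h<k x0 y0)
                             (det-point-on-line (+ h) (+ k) (tStar n m h k x0 y0) hy0≡kx0-1))
  where
  0<h : 0 < h
  0<h = subst (0 <_) (ℕ.*-identityʳ h) 0/1<h/k
  h<k : h < k
  h<k = subst₂ _<_ (ℕ.*-identityʳ h) (ℕ.*-identityˡ k) h/k<1/1
  open Neighbours 0<m m<n hk∈FB 0<h h<k
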